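{- Let $x$ be a node of the tree, and suppose that the field $x.\mathit{version}$ is modified only by the compare-and-swap steps of calls to $\mathrm{Refresh}(x)$ described in the context. If two distinct calls to $\mathrm{Refresh}(x)$ on the same node $x$ both perform successful compare-and-swap steps on $x.\mathit{version}$, then one of the two calls performs its initial read of $x.\mathit{version}$ after the successful compare-and-swap of the other call.
   Context: We consider an asynchronous shared-memory system in which processes take atomic steps (reads, writes, and compare-and-swap) on shared memory. A compare-and-swap $\mathrm{CAS}(f,\mathit{old},\mathit{new})$ atomically reads the field $f$; if $f$ equals $\mathit{old}$, it writes $\mathit{new}$ into $f$; in either case it returns the value it read. It is successful if the value returned equals $\mathit{old}$. Each tree node $x$ has a field $x.\mathit{version}$ holding a pointer to a Version object. A call $\mathrm{Refresh}(x)$ executes the following steps in order: (1) it reads $x.\mathit{version}$ into a local variable $\mathit{old}$; (2) it reads the children of $x$ and their version pointers (possibly repeatedly); (3) it allocates a brand-new Version object $\mathit{new}$, so its address differs from every value that has previously been stored in $x.\mathit{version}$; (4) it performs $\mathrm{CAS}(x.\mathit{version},\mathit{old},\mathit{new})$ and returns whether this compare-and-swap was successful. -}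

module Defs where

open import Data.Nat using (ℕ; zero; suc; _<_; _≤_; _≟_)
open import Data.List using (List; []; _∷_)
open import Data.Maybe using (Maybe; just; nothing)
open import Data.Product using (Σ; _×_)
open import Relation.Nullary using (¬_; yes; no)
open import Relation.Binary.PropositionalEquality using (_≡_)

-- Model of an execution, restricted to what concerns the single field x.version
-- of a fixed node x.  Values stored in x.version (pointers to Version objects)
-- are addresses, modelled as ℕ.
Addr : Set
Addr = ℕ

CallId : Set
CallId = ℕ

-- The only steps that touch x.version are the
-- read in line (1) of a Refresh(x) call and the CAS in line (4) of a
-- Refresh(x) call (hypothesis: x.version is modified only by those CAS steps).
-- Every other step (reads of children, allocations, steps on other memory)
-- is `other`.
data Event : Set where
  read  : CallId → Event
  cas   : CallId → Addr → Addr → Event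
  other : Event

stepVal : Addr → Event → Addr
stepVal v (read _)      = v
stepVal v (cas _ o n) with v ≟ o
... | yes _ = n
... | no  _ = v
stepVal v other         = v

-- Content of x.version just before step k (i.e. after the first k steps),
-- starting from initial content v0.  This is also the value returned by a
-- read or CAS performed at step k.
valBefore : Addr → List Event → ℕ → Addr
valBefore v0 []       _       = v0
valBefore v0 (e ∷ es) zero    = v0
valBefore v0 (e ∷ es) (suc k) = valBefore (stepVal v0 e) es k

at : List Event → ℕ → Maybe Event
at []       _       = nothing
at (e ∷ es) zero    = just e
at (e ∷ es) (suc k) = at es k

Successful : Addr → List Event → ℕ → Addr → Set
Successful v0 E i o = valBefore v0 E i ≡ o

record WellFormed (v0 : Addr) (E : List Event) : Set where
  field
    read-unique : ∀ {c i j} → at E i ≡ just (read c) → at E j ≡ just (read c) → i ≡ j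
    cas-unique  : ∀ {c o o' n n' i j} → at E i ≡ just (cas c o n) → at E j ≡ just (cas c o' n') → i ≡ j
    cas-old     : ∀ {c o n i} → at E i ≡ just (cas c o n) →
                  Σ ℕ (λ j → j < i × at E j ≡ just (read c) × o ≡ valBefore v0 E j)
    -- `new` is a freshly allocated address: it differs from every value that
    -- has previously been stored in x.version (initial value included)
    cas-fresh   : ∀ {c o n i} → at E i ≡ just (cas c o n) →
                  ∀ k → k ≤ i → ¬ (n ≡ valBefore v0 E k)

{-# OPTIONS --safe #-}
module Submission where

-- Every value a CAS stores in x.version is fresh, so once x.version changes it
-- never again holds a value it held before (there is no ABA).  A call whose CAS
-- succeeds finds x.version holding the value of its initial read, so x.version
-- did not change between that read and the CAS.  Of two successful CASes the
-- earlier one changes x.version, hence it cannot lie in that window of the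
-- later call: the later call read x.version only after the earlier CAS.

open import Defs
open import Data.Nat using (ℕ; zero; suc; _<_; _≤_; _≟_; s≤s)
open import Data.Nat.Properties using (_≤?_; <-cmp; ≰⇒>; <⇒≤; ≤-refl; ≤-trans; m≤n⇒m<n∨m≡n)
open import Data.List using (List; []; _∷_)
open import Data.Maybe using (just; nothing; maybe′)
open import Data.Maybe.Properties using (just-injective)
open import Data.Product using (_×_; _,_; ∃-syntax)
open import Data.Sum using (_⊎_; inj₁; inj₂)
open import Relation.Nullary using (¬_; yes; no; contradiction)
open import Relation.Binary using (tri<; tri≈; tri>)
open import Relation.Binary.PropositionalEquality
  using (_≡_; _≢_; refl; sym; trans; cong; module ≡-Reasoning)

stepVal-cas : ∀ v c o n → stepVal v (cas c o n) ≡ n ⊎ stepVal v (cas c o n) ≡ v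
stepVal-cas v c o n with v ≟ o
... | yes _ = inj₁ refl
... | no  _ = inj₂ refl

stepVal-cas-success : ∀ c o n → stepVal o (cas c o n) ≡ n
stepVal-cas-success c o n with o ≟ o
... | yes _   = refl
... | no  o≢o = contradiction refl o≢o

valBefore-zero : ∀ v0 E → valBefore v0 E 0 ≡ v0
valBefore-zero v0 []      = refl
valBefore-zero v0 (_ ∷ _) = refl

valBefore-suc : ∀ v0 E k →
                valBefore v0 E (suc k) ≡ maybe′ (stepVal (valBefore v0 E k)) (valBefore v0 E k) (at E k)
valBefore-suc v0 []      k       = refl
valBefore-suc v0 (e ∷ E) zero    = valBefore-zero (stepVal v0 e) E
valBefore-suc v0 (e ∷ E) (suc k) = valBefore-suc (stepVal v0 e) E k

valBefore-unchanged-or-cas : ∀ v0 E k →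
  valBefore v0 E (suc k) ≡ valBefore v0 E k ⊎
  ∃[ c ] ∃[ o ] ∃[ n ] (at E k ≡ just (cas c o n) × valBefore v0 E (suc k) ≡ n)
valBefore-unchanged-or-cas v0 E k rewrite valBefore-suc v0 E k with at E k
... | nothing         = inj₁ refl
... | just (read _)   = inj₁ refl
... | just other      = inj₁ refl
... | just (cas c o n) with stepVal-cas (valBefore v0 E k) c o n
...   | inj₁ wrote = inj₂ (c , o , n , refl , wrote)
...   | inj₂ kept  = inj₁ kept

successful-cas-writes : ∀ {v0 E i c o n} → at E i ≡ just (cas c o n) → Successful v0 E i o →
                        valBefore v0 E (suc i) ≡ n
successful-cas-writes {v0} {E} {i} {c} {o} {n} casᵢ success = begin
  valBefore v0 E (suc i)                                           ≡⟨ valBefore-suc v0 E i ⟩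
  maybe′ (stepVal (valBefore v0 E i)) (valBefore v0 E i) (at E i)  ≡⟨ cong (maybe′ _ _) casᵢ ⟩
  stepVal (valBefore v0 E i) (cas c o n)                           ≡⟨ cong (λ v → stepVal v (cas c o n)) success ⟩
  stepVal o (cas c o n)                                            ≡⟨ stepVal-cas-success c o n ⟩
  n                                                                ∎
  where open ≡-Reasoning

UnseenUpTo : Addr → List Event → ℕ → ℕ → Set
UnseenUpTo v0 E i k = ∀ {m} → m ≤ i → valBefore v0 E k ≢ valBefore v0 E m

module _ {v0 : Addr} {E : List Event} (W : WellFormed v0 E) where
  open WellFormed W

  private
    val : ℕ → Addr
    val = valBefore v0 E

  step-unchanged-or-fresh : ∀ k → val (suc k) ≡ val k ⊎ UnseenUpTo v0 E k (suc k)
  step-unchanged-or-fresh k with valBefore-unchanged-or-cas v0 E k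
  ... | inj₁ unchanged                 = inj₁ unchanged
  ... | inj₂ (c , o , n , casₖ , wrote) =
    inj₂ λ m≤k same → cas-fresh casₖ _ m≤k (trans (sym wrote) same)

  unseenUpTo-step : ∀ {i k} → i ≤ k → UnseenUpTo v0 E i k → UnseenUpTo v0 E i (suc k)
  unseenUpTo-step {k = k} i≤k unseen with step-unchanged-or-fresh k
  ... | inj₁ unchanged = λ m≤i same → unseen m≤i (trans (sym unchanged) same)
  ... | inj₂ fresh     = λ m≤i → fresh (≤-trans m≤i i≤k)

  unseenUpTo-persists : ∀ {i k} → UnseenUpTo v0 E i (suc i) → i < k → UnseenUpTo v0 E i k
  unseenUpTo-persists {k = suc k} fresh (s≤s i≤k) with m≤n⇒m<n∨m≡n i≤k
  ... | inj₂ refl = fresh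
  ... | inj₁ i<k  = unseenUpTo-step (<⇒≤ i<k) (unseenUpTo-persists fresh i<k)

  no-ABA : ∀ {r j k} → r ≤ j → j < k → val k ≡ val r → val (suc j) ≡ val j
  no-ABA r≤j j<k same with step-unchanged-or-fresh _
  ... | inj₁ unchanged = unchanged
  ... | inj₂ fresh     = contradiction same (unseenUpTo-persists fresh j<k r≤j)

  successful-cas-changes : ∀ {i c o n} → at E i ≡ just (cas c o n) → Successful v0 E i o →
                           val (suc i) ≢ val i
  successful-cas-changes casᵢ success same =
    cas-fresh casᵢ _ ≤-refl (trans (sym (successful-cas-writes {v0} {E} casᵢ success)) same)

  successful-cas-sees-read : ∀ {i r c o n} → at E i ≡ just (cas c o n) → Successful v0 E i o →
                             at E r ≡ just (read c) → val i ≡ val r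
  successful-cas-sees-read casᵢ success readᵣ with cas-old casᵢ
  ... | j , _ , readⱼ , o≡valⱼ =
    trans success (trans o≡valⱼ (cong val (read-unique readⱼ readᵣ)))

  later-successful-cas-reads-after : ∀ {c₁ c₂ o₁ n₁ o₂ n₂ i₁ i₂ r₂} → i₁ < i₂ →
    at E i₁ ≡ just (cas c₁ o₁ n₁) → Successful v0 E i₁ o₁ →
    at E i₂ ≡ just (cas c₂ o₂ n₂) → Successful v0 E i₂ o₂ →
    at E r₂ ≡ just (read c₂) → i₁ < r₂
  later-successful-cas-reads-after {i₁ = i₁} {r₂ = r₂} i₁<i₂ cas₁ ok₁ cas₂ ok₂ read₂ with r₂ ≤? i₁
  ... | no  r₂≰i₁ = ≰⇒> r₂≰i₁
  ... | yes r₂≤i₁ = contradiction (no-ABA r₂≤i₁ i₁<i₂ (successful-cas-sees-read cas₂ ok₂ read₂))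
                                  (successful-cas-changes cas₁ ok₁)

lemmaB7 : (v0 : Addr) (E : List Event) → WellFormed v0 E →
          ∀ {c₁ c₂ : CallId} {o₁ n₁ o₂ n₂ : Addr} {i₁ i₂ r₁ r₂ : ℕ} →
          ¬ (c₁ ≡ c₂) →
          at E i₁ ≡ just (cas c₁ o₁ n₁) → Successful v0 E i₁ o₁ →
          at E i₂ ≡ just (cas c₂ o₂ n₂) → Successful v0 E i₂ o₂ →
          at E r₁ ≡ just (read c₁) → at E r₂ ≡ just (read c₂) →
          (i₁ < r₂) ⊎ (i₂ < r₁)
lemmaB7 v0 E W {i₁ = i₁} {i₂} c₁≢c₂ cas₁ ok₁ cas₂ ok₂ read₁ read₂ with <-cmp i₁ i₂
... | tri< i₁<i₂ _ _ = inj₁ (later-successful-cas-reads-after W i₁<i₂ cas₁ ok₁ cas₂ ok₂ read₂)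
... | tri> _ _ i₂<i₁ = inj₂ (later-successful-cas-reads-after W i₂<i₁ cas₂ ok₂ cas₁ ok₁ read₁)
... | tri≈ _ refl _ with just-injective (trans (sym cas₁) cas₂)
...   | refl = contradiction refl c₁≢c₂
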